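{- Let $G$ be an $s$-$t$-DAG with flow $f$, let $k$ be a positive integer, and let $T_n$ be the final table constructed as in the context. An integer vector $\mathbf{w}\in\mathbb{Z}^k$ is a solution to the linear system $L$ of some pair $(g,L)\in T_n$ if and only if there is a set of $s$-$t$-paths $P=p_1,\dots,p_k$ such that $(P,\mathbf{w})$ is a flow decomposition of $(G,f)$.
   Context: An $s$-$t$-DAG is a directed acyclic (multi)graph $G=(V,A)$ with unique source $s$ and unique sink $t$. A flow $f$ assigns a positive integer to every arc with inflow equal to outflow at every vertex other than $s,t$; $F$ is the total flow out of $s$. $(P,\mathbf{w})$ with $P=p_1,\dots,p_k$ $s$-$t$-paths and $\mathbf{w}=(w_1,\dots,w_k)$ is a flow decomposition if $f(a)=\sum_{i=1}^k w_i\mathbf{1}_{p_i}(a)$ for every arc $a$ ($\mathbf{1}_{p_i}(a)=1$ if $a\in p_i$, else $0$). Tables: Fix a topological order $v_1=s,\dots,v_n=t$, let $S_i=\{v_j:j\le i\}$ and $A^+(S)$ the set of arcs from $S$ to $V\setminus S$. Add a dummy arc $a_s$ entering $s$ and a dummy arc $a_t$ leaving $t$ with $f(a_s)=f(a_t)=F$; set $A^+(S_0)=\{a_s\}$ and regard $a_t$ as an out-arc of $v_n$. A routing out of $S_i$ is a surjective map $g:[k]\to A^+(S_i)$. A routing $g'$ out of $S_i$ extends a routing $g$ out of $S_{i-1}$ if for each $j\in[k]$: if $g'(j)=xy$ with $x\neq v_i$ then $g(j)=xy$, and if $g'(j)=xy$ with $x=v_i$ then $g(j)=zv_i$ for some $z\in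 S_{i-1}$. $T_0=\{(g_0,L_0)\}$ with $g_0\equiv a_s$ and $L_0$ the single equation $\sum_{j=1}^k w_j=F$. For $i=1,\dots,n$, $T_i$ consists of all pairs $(g',L')$ where $(g,L)\in T_{i-1}$, $g'$ is an extension of $g$ out of $S_i$, and $L'$ is $L$ together with the equations $\sum_{j\in g'^{ -1}(a)}w_j=f(a)$ for every out-arc $a$ of $v_i$. -}

module Defs where

open import Data.Nat using (ℕ; zero; suc; _<_; _≤_; _≟_)
open import Data.Fin using (Fin; toℕ)
import Data.Fin as F
open import Data.Bool using (Bool; true; false; if_then_else_)
open import Data.List using (List; []; _∷_; _++_; map; filter)
import Data.List
open import Data.List.Base using ()
open import Data.Integer using (ℤ; +_; 0ℤ) renaming (_+_ to _+ℤ_; _*_ to _*ℤ_)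
open import Data.Product using (_×_; ∃; _,_)
open import Data.Empty using (⊥)
open import Relation.Nullary using (¬_; Dec; yes; no)
open import Relation.Nullary.Decidable using (⌊_⌋)
open import Relation.Binary.PropositionalEquality using (_≡_; refl; cong)
import Data.List.Membership.DecPropositional as DecMem

sumℕ : ∀ {n} → (Fin n → ℕ) → ℕ
sumℕ {zero}  h = 0
sumℕ {suc n} h = h F.zero Data.Nat.+ sumℕ (λ i → h (F.suc i))

sumℤ : ∀ {n} → (Fin n → ℤ) → ℤ
sumℤ {zero}  h = 0ℤ
sumℤ {suc n} h = h F.zero +ℤ sumℤ (λ i → h (F.suc i))

record MultiDigraph : Set where
  field
    nV : ℕ
    nA : ℕ
    tl : Fin nA → Fin nV
    hd : Fin nA → Fin nV
open MultiDigraph public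

module _ (G : MultiDigraph) where

  -- vertex with index x (0-based) is v_{x+1} of the topological order
  IsS : Fin (nV G) → Set
  IsS v = toℕ v ≡ 0

  IsT : Fin (nV G) → Set
  IsT v = suc (toℕ v) ≡ nV G

  -- An s-t-DAG whose vertex numbering 0,1,..,nV-1 is the fixed
  -- topological order v_1 = s, ..., v_n = t.
  record IsSTDAG : Set where
    field
      twoVertices : 2 ≤ nV G                              -- s ≠ t
      topOrder    : ∀ a → toℕ (tl G a) < toℕ (hd G a)    -- acyclic, order is topological
      uniqueSource : ∀ v → ¬ IsS v → ∃ λ a → hd G a ≡ v
      uniqueSink   : ∀ v → ¬ IsT v → ∃ λ a → tl G a ≡ v

  inflow : (Fin (nA G) → ℕ) → Fin (nV G) → ℕ
  inflow f v = sumℕ (λ a → if ⌊ hd G a F.≟ v ⌋ then f a else 0)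

  outflow : (Fin (nA G) → ℕ) → Fin (nV G) → ℕ
  outflow f v = sumℕ (λ a → if ⌊ tl G a F.≟ v ⌋ then f a else 0)

  record IsFlow (f : Fin (nA G) → ℕ) : Set where
    field
      positive     : ∀ a → 1 ≤ f a
      conservation : ∀ v → ¬ IsS v → ¬ IsT v → inflow f v ≡ outflow f v

  totalFlow : (Fin (nA G) → ℕ) → ℕ
  totalFlow f = sumℕ (λ a → if ⌊ toℕ (tl G a) ≟ 0 ⌋ then f a else 0)

  data PathFrom : ℕ → List (Fin (nA G)) → Set where
    done : ∀ {x} → suc x ≡ nV G → PathFrom x []
    cons : ∀ {x a as} → toℕ (tl G a) ≡ x → PathFrom (toℕ (hd G a)) as →
           PathFrom x (a ∷ as)

  IsSTPath : List (Fin (nA G)) → Set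
  IsSTPath p = PathFrom 0 p

  ind : List (Fin (nA G)) → Fin (nA G) → ℕ
  ind p a = if ⌊ a ∈? p ⌋ then 1 else 0
    where open DecMem (F._≟_ {nA G})

  record IsFlowDecomposition (f : Fin (nA G) → ℕ) (k : ℕ)
         (P : Fin k → List (Fin (nA G))) (w : Fin k → ℤ) : Set where
    field
      paths : ∀ j → IsSTPath (P j)
      sums  : ∀ a → + f a ≡ sumℤ (λ j → w j *ℤ + ind (P j) a)

  -- Arcs extended by the dummy arcs a_s (entering s) and a_t (leaving t)

  data EArc : Set where
    arc : Fin (nA G) → EArc
    aS  : EArc
    aT  : EArc

  _≟E_ : (e e' : EArc) → Dec (e ≡ e')
  arc a ≟E arc b with a F.≟ b
  ... | yes refl = yes refl
  ... | no  a≢b  = no λ { refl → a≢b refl }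
  arc a ≟E aS = no λ ()
  arc a ≟E aT = no λ ()
  aS ≟E arc b = no λ ()
  aS ≟E aS = yes refl
  aS ≟E aT = no λ ()
  aT ≟E arc b = no λ ()
  aT ≟E aS = no λ ()
  aT ≟E aT = yes refl

  fE : (Fin (nA G) → ℕ) → EArc → ℕ
  fE f (arc a) = f a
  fE f aS      = totalFlow f
  fE f aT      = totalFlow f

  -- e ∈ A⁺(S_i), where S_i = {vertices with index < i} = {v_1,..,v_i}
  InCut : ℕ → EArc → Set
  InCut i (arc a) = toℕ (tl G a) < i × i ≤ toℕ (hd G a)
  InCut i aS      = i ≡ 0
  InCut i aT      = i ≡ nV G

  TailIs : EArc → ℕ → Set
  TailIs (arc a) x = toℕ (tl G a) ≡ x
  TailIs aS      x = ⊥
  TailIs aT      x = suc x ≡ nV G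

  HeadIs : EArc → ℕ → Set
  HeadIs (arc a) x = toℕ (hd G a) ≡ x
  HeadIs aS      x = x ≡ 0
  HeadIs aT      x = ⊥

  outArcs : ℕ → List EArc
  outArcs x = map arc (filter (λ a → toℕ (tl G a) ≟ x) (Data.List.allFin (nA G)))
              ++ (if ⌊ suc x ≟ nV G ⌋ then aT ∷ [] else [])

  module _ (k : ℕ) where

    record Routing (i : ℕ) (g : Fin k → EArc) : Set where
      field
        into : ∀ j → InCut i (g j)
        onto : ∀ e → InCut i e → ∃ λ j → g j ≡ e

    -- g' (out of S_{x+1}) extends g (out of S_x); the processed vertex is
    -- v_{x+1}, i.e. the vertex with index x.
    Extends : ℕ → (Fin k → EArc) → (Fin k → EArc) → Set
    Extends x g g' = ∀ j → (¬ TailIs (g' j) x → g j ≡ g' j)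
                         × (TailIs (g' j) x → HeadIs (g j) x)

    record Equation : Set where
      constructor mkEq
      field
        idx : Fin k → Bool
        rhs : ℕ

    Satisfies : (Fin k → ℤ) → Equation → Set
    Satisfies w (mkEq idx r) = sumℤ (λ j → if idx j then w j else 0ℤ) ≡ + r

    data Solves (w : Fin k → ℤ) : List Equation → Set where
      []  : Solves w []
      _∷_ : ∀ {e L} → Satisfies w e → Solves w L → Solves w (e ∷ L)

    preimage : (Fin k → EArc) → EArc → Fin k → Bool
    preimage g e j = ⌊ g j ≟E e ⌋

    newEqs : (Fin (nA G) → ℕ) → ℕ → (Fin k → EArc) → List Equation
    newEqs f x g' = map (λ e → mkEq (preimage g' e) (fE f e)) (outArcs x)

    data InTable (f : Fin (nA G) → ℕ) : ℕ → (Fin k → EArc) → List Equation → Set where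
      base : InTable f 0 (λ _ → aS) (mkEq (λ _ → true) (totalFlow f) ∷ [])
      step : ∀ {x g L g'} → suc x ≤ nV G → InTable f x g L →
             Routing (suc x) g' → Extends x g g' →
             InTable f (suc x) g' (L ++ newEqs f x g')

-- Table ⇒ decomposition: processing v_{x+1}, extend path j by g'(j) whenever that arc leaves
-- v_{x+1}. The extension condition keeps path j a walk from s to the head of g(j), and after
-- v_n every index is routed to a_t, so the paths are s-t-paths. An arc a leaving v_{x+1} is
-- appended exactly to the paths j with g'(j) = a, so the equation added for a is the
-- decomposition equation for a.
-- Decomposition ⇒ table: route j out of S_i through the arc of p_j crossing the cut S_i.
-- These routings extend one another; they are surjective since f > 0 puts every arc on some
-- path (and k ≥ 1 covers a_t); the arc equations are the decomposition equations, and the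
-- equations for a_s and a_t say Σ w = F because every s-t-path leaves s exactly once.
module Submission where

open import Defs
open import Data.Bool using (Bool; true; if_then_else_)
open import Data.Empty using (⊥-elim)
open import Data.Fin using (Fin; toℕ)
import Data.Fin as F
import Data.Fin.Properties as FP
open import Data.Integer using (ℤ; +_; 0ℤ; 1ℤ) renaming (_+_ to _+ℤ_; _*_ to _*ℤ_)
import Data.Integer.Properties as ℤ
open import Algebra.Properties.Semiring.Sum ℤ.+-*-semiring
  using (sum; sum-cong-≗; sum-replicate-zero; ∑-comm; *-distribˡ-sum)
open import Data.List using (List; []; _∷_; _++_; allFin)
open import Data.List.Membership.Propositional using (_∈_)
open import Data.List.Membership.Propositional.Properties
  using (∈-++⁺ˡ; ∈-++⁺ʳ; ∈-++⁻; ∈-map⁺; ∈-filter⁺; ∈-allFin)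
import Data.List.Membership.DecPropositional as DecMembership
open import Data.List.Relation.Unary.All as All using (All; []; _∷_)
import Data.List.Relation.Unary.All.Properties as All
open import Data.List.Relation.Unary.Any using (here; there)
open import Data.Nat using (ℕ; zero; suc; _≤_; _<_; z≤n; s≤s; _≤?_) renaming (_≟_ to _≟ℕ_)
import Data.Nat.Properties as ℕ
open import Data.Product using (∃; _×_; _,_; proj₁; proj₂)
open import Data.Sum using (_⊎_; inj₁; inj₂; [_,_])
open import Function using (_∘_; id)
open import Function.Bundles using (_⇔_; mk⇔)
open import Relation.Nullary using (¬_; Dec; yes; no)
open import Relation.Nullary.Decidable using (⌊_⌋; isYes≗does; does-⇔)
open import Relation.Binary.PropositionalEquality
  using (_≡_; _≢_; refl; sym; trans; cong; subst; module ≡-Reasoning)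

⌊⌋-⇔ : ∀ {A B : Set} → A ⇔ B → (a? : Dec A) (b? : Dec B) → ⌊ a? ⌋ ≡ ⌊ b? ⌋
⌊⌋-⇔ A⇔B a? b? = trans (isYes≗does a?) (trans (does-⇔ A⇔B a? b?) (sym (isYes≗does b?)))

sumℤ≗sum : ∀ {n} (h : Fin n → ℤ) → sumℤ h ≡ sum h
sumℤ≗sum {zero}  h = refl
sumℤ≗sum {suc n} h = cong (h F.zero +ℤ_) (sumℤ≗sum (h ∘ F.suc))

sumℤ-via-sum : ∀ {m n} {h : Fin m → ℤ} {h' : Fin n → ℤ} →
               sum h ≡ sum h' → sumℤ h ≡ sumℤ h'
sumℤ-via-sum {h = h} {h'} eq = trans (sumℤ≗sum h) (trans eq (sym (sumℤ≗sum h')))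

sumℤ-cong : ∀ {n} {h h' : Fin n → ℤ} → (∀ i → h i ≡ h' i) → sumℤ h ≡ sumℤ h'
sumℤ-cong {h = h} {h'} h≗h' = sumℤ-via-sum {h = h} {h'} (sum-cong-≗ h≗h')

sumℤ-zero : ∀ n → sumℤ {n} (λ _ → 0ℤ) ≡ 0ℤ
sumℤ-zero n = trans (sumℤ≗sum {n} (λ _ → 0ℤ)) (sum-replicate-zero n)

sumℤ-comm : ∀ {m n} (h : Fin m → Fin n → ℤ) →
            sumℤ (λ i → sumℤ (h i)) ≡ sumℤ (λ j → sumℤ (λ i → h i j))
sumℤ-comm h = sumℤ-via-sum {h = λ i → sumℤ (h i)} {λ j → sumℤ (λ i → h i j)} (begin
  sum (λ i → sumℤ (h i))         ≡⟨ sum-cong-≗ (λ i → sumℤ≗sum (h i)) ⟩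
  sum (λ i → sum (h i))          ≡⟨ ∑-comm h ⟩
  sum (λ j → sum (λ i → h i j))  ≡⟨ sum-cong-≗ (λ j → sumℤ≗sum (λ i → h i j)) ⟨
  sum (λ j → sumℤ (λ i → h i j)) ∎)
  where open ≡-Reasoning

sumℤ-*ˡ : ∀ {n} c (h : Fin n → ℤ) → sumℤ (λ i → c *ℤ h i) ≡ c *ℤ sumℤ h
sumℤ-*ˡ c h = begin
  sumℤ (λ i → c *ℤ h i) ≡⟨ sumℤ≗sum (λ i → c *ℤ h i) ⟩
  sum (λ i → c *ℤ h i)  ≡⟨ *-distribˡ-sum c h ⟨
  c *ℤ sum h            ≡⟨ cong (c *ℤ_) (sumℤ≗sum h) ⟨
  c *ℤ sumℤ h           ∎
  where open ≡-Reasoning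

+-sumℕ : ∀ {n} (h : Fin n → ℕ) → + sumℕ h ≡ sumℤ (λ i → + h i)
+-sumℕ {zero}  h = refl
+-sumℕ {suc n} h = trans (ℤ.pos-+ (h F.zero) _) (cong (+ h F.zero +ℤ_) (+-sumℕ (h ∘ F.suc)))

sumℤ-indicator : ∀ {n} (b : Fin n) (h : Fin n → ℤ) →
                 sumℤ (λ a → if ⌊ a F.≟ b ⌋ then h a else 0ℤ) ≡ h b
sumℤ-indicator {suc n} F.zero    h = trans (cong (h F.zero +ℤ_) (sumℤ-zero n)) (ℤ.+-identityʳ _)
sumℤ-indicator {suc n} (F.suc b) h =
  trans (ℤ.+-identityˡ _) (trans (sumℤ-cong shift) (sumℤ-indicator b (h ∘ F.suc)))
  where
  shift : ∀ i → (if ⌊ F.suc i F.≟ F.suc b ⌋ then h (F.suc i) else 0ℤ)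
              ≡ (if ⌊ i F.≟ b ⌋ then h (F.suc i) else 0ℤ)
  shift i with i F.≟ b
  ... | yes _ = refl
  ... | no  _ = refl

module _ {G : MultiDigraph} {k : ℕ} {w : Fin k → ℤ} where

  Solves⇒All : ∀ {L} → Solves G k w L → All (Satisfies G k w) L
  Solves⇒All []      = []
  Solves⇒All (e ∷ s) = e ∷ Solves⇒All s

  All⇒Solves : ∀ {L} → All (Satisfies G k w) L → Solves G k w L
  All⇒Solves []      = []
  All⇒Solves (e ∷ s) = e ∷ All⇒Solves s

module Digraph (G : MultiDigraph) where
  open DecMembership (F._≟_ {nA G}) using (_∈?_)

  Arc : Set
  Arc = Fin (nA G)

  ind-∈ : ∀ {p a} → a ∈ p → ind G p a ≡ 1
  ind-∈ {p} {a} a∈p with a ∈? p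
  ... | yes _   = refl
  ... | no  a∉p = ⊥-elim (a∉p a∈p)

  ind-∉ : ∀ {p a} → ¬ a ∈ p → ind G p a ≡ 0
  ind-∉ {p} {a} a∉p with a ∈? p
  ... | yes a∈p = ⊥-elim (a∉p a∈p)
  ... | no  _   = refl

  ind-cong : ∀ {p q a} → a ∈ p ⇔ a ∈ q → ind G p a ≡ ind G q a
  ind-cong {p} {q} {a} p⇔q = cong (λ b → if b then 1 else 0) (⌊⌋-⇔ p⇔q (a ∈? p) (a ∈? q))

  *-ind : ∀ c p a → c *ℤ + ind G p a ≡ (if ⌊ a ∈? p ⌋ then c else 0ℤ)
  *-ind c p a with a ∈? p
  ... | yes _ = ℤ.*-identityʳ c
  ... | no  _ = ℤ.*-zeroʳ c

  sum-preimage : ∀ {k} (w : Fin k → ℤ) (g : Fin k → EArc G) (P : Fin k → List Arc) a →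
                 (∀ j → g j ≡ arc a ⇔ a ∈ P j) →
                 sumℤ (λ j → if preimage G k g (arc a) j then w j else 0ℤ)
                 ≡ sumℤ (λ j → w j *ℤ + ind G (P j) a)
  sum-preimage w g P a g⇔∈ = sumℤ-cong λ j →
    trans (cong (λ b → if b then w j else 0ℤ) (⌊⌋-⇔ (g⇔∈ j) (_≟E_ G (g j) (arc a)) (a ∈? P j)))
          (sym (*-ind (w j) (P j) a))

  ∈-outArcs : ∀ {a x} → toℕ (tl G a) ≡ x → arc a ∈ outArcs G x
  ∈-outArcs {a} {x} tl≡x =
    ∈-++⁺ˡ (∈-map⁺ arc (∈-filter⁺ (λ b → toℕ (tl G b) ≟ℕ x) (∈-allFin a) tl≡x))

  outArcs-tails : ∀ x → All (λ e → TailIs G e x) (outArcs G x)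
  outArcs-tails x =
    All.++⁺ (All.map⁺ (All.all-filter (λ a → toℕ (tl G a) ≟ℕ x) (allFin (nA G)))) aT-tail
    where
    aT-tail : All (λ e → TailIs G e x) (if ⌊ suc x ≟ℕ nV G ⌋ then aT ∷ [] else [])
    aT-tail with suc x ≟ℕ nV G
    ... | yes 1+x≡n = 1+x≡n ∷ []
    ... | no  _     = []

  ExtendsAt : ℕ → EArc G → EArc G → Set
  ExtendsAt x e e' = (¬ TailIs G e' x → e ≡ e') × (TailIs G e' x → HeadIs G e x)

  data Walk : ℕ → List Arc → ℕ → Set where
    nil : ∀ {x} → Walk x [] x
    cons : ∀ {x a as y} → toℕ (tl G a) ≡ x → Walk (toℕ (hd G a)) as y → Walk x (a ∷ as) y

  walk-snoc : ∀ {x p y a} → Walk x p y → toℕ (tl G a) ≡ y → Walk x (p ++ a ∷ []) (toℕ (hd G a))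
  walk-snoc nil        tl≡y = cons tl≡y nil
  walk-snoc (cons t w) tl≡y = cons t (walk-snoc w tl≡y)

  walk⇒path : ∀ {x p y} → Walk x p y → suc y ≡ nV G → PathFrom G x p
  walk⇒path nil        1+y≡n = done 1+y≡n
  walk⇒path (cons t w) 1+y≡n = cons t (walk⇒path w 1+y≡n)

module STDAG (G : MultiDigraph) (dag : IsSTDAG G) where
  open Digraph G
  open IsSTDAG dag

  0≢n : 0 ≢ nV G
  0≢n = ℕ.<⇒≢ (ℕ.<-trans (s≤s z≤n) twoVertices)

  1≢n : 1 ≢ nV G
  1≢n = ℕ.<⇒≢ twoVertices

  InCut-n⇒≡aT : ∀ {i} e → InCut G i e → i ≡ nV G → e ≡ aT
  InCut-n⇒≡aT (arc a) (_ , n≤hd) refl = ⊥-elim (ℕ.<⇒≱ (FP.toℕ<n (hd G a)) n≤hd)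
  InCut-n⇒≡aT aS      i≡0        i≡n  = ⊥-elim (0≢n (trans (sym i≡0) i≡n))
  InCut-n⇒≡aT aT      _          _    = refl

  start≤tail : ∀ {y p b} → PathFrom G y p → b ∈ p → y ≤ toℕ (tl G b)
  start≤tail (cons t _) (here refl) = ℕ.≤-reflexive (sym t)
  start≤tail (cons {a = a} t rest) (there b∈rest) =
    subst (_≤ _) t (ℕ.<⇒≤ (ℕ.<-≤-trans (topOrder a) (start≤tail rest b∈rest)))

  leaves-s-once : ∀ {p} → IsSTPath G p →
                  sumℤ (λ a → if ⌊ toℕ (tl G a) ≟ℕ 0 ⌋ then + ind G p a else 0ℤ) ≡ 1ℤ
  leaves-s-once (done 1≡n) = ⊥-elim (1≢n 1≡n)
  leaves-s-once {b ∷ p} (cons tl-b≡0 rest) =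
    trans (sumℤ-cong first-arc) (sumℤ-indicator b (λ _ → 1ℤ))
    where
    first-arc : ∀ a → (if ⌊ toℕ (tl G a) ≟ℕ 0 ⌋ then + ind G (b ∷ p) a else 0ℤ)
                      ≡ (if ⌊ a F.≟ b ⌋ then 1ℤ else 0ℤ)
    first-arc a = first-arc-by a (toℕ (tl G a) ≟ℕ 0) (a F.≟ b)
      where
      -- deciding a ≟ b by a separate argument keeps it from being abstracted inside ind
      first-arc-by : ∀ a (tl≟0 : Dec (toℕ (tl G a) ≡ 0)) (a≟b : Dec (a ≡ b)) →
                     (if ⌊ tl≟0 ⌋ then + ind G (b ∷ p) a else 0ℤ) ≡ (if ⌊ a≟b ⌋ then 1ℤ else 0ℤ)
      first-arc-by a (yes _)      (yes refl) = cong +_ (ind-∈ (here refl))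
      first-arc-by a (no tl-a≢0)  (yes refl) = ⊥-elim (tl-a≢0 tl-b≡0)
      first-arc-by a (no _)       (no _)     = refl
      first-arc-by a (yes tl-a≡0) (no a≢b)   = cong +_ (ind-∉ λ
        { (here a≡b)  → a≢b a≡b
        ; (there a∈p) → ℕ.n≮0 (ℕ.<-≤-trans (topOrder b)
                                            (subst (_ ≤_) tl-a≡0 (start≤tail rest a∈p))) })

  -- The arc through which a walk leaves S_i: its first arc with head index ≥ i.
  crossing : ℕ → List Arc → EArc G
  crossing zero    p       = aS
  crossing (suc i) []      = aT
  crossing (suc i) (a ∷ p) = if ⌊ suc i ≤? toℕ (hd G a) ⌋ then arc a else crossing (suc i) p

  crossing-inCut : ∀ i {y p} → PathFrom G y p → y ≤ i → suc i ≤ nV G →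
                   InCut G (suc i) (crossing (suc i) p)
  crossing-inCut i (done 1+y≡n) y≤i i<n = ℕ.≤-antisym i<n (subst (_≤ suc i) 1+y≡n (s≤s y≤i))
  crossing-inCut i (cons {a = a} t rest) y≤i i<n with suc i ≤? toℕ (hd G a)
  ... | yes i<hd = s≤s (subst (_≤ i) (sym t) y≤i) , i<hd
  ... | no  i≮hd = crossing-inCut i rest (ℕ.≤-pred (ℕ.≰⇒> i≮hd)) i<n

  crossing-≡arc : ∀ i {y p a} → PathFrom G y p → y ≤ i → a ∈ p → InCut G (suc i) (arc a) →
                  crossing (suc i) p ≡ arc a
  crossing-≡arc i (cons {a = b} t rest) y≤i a∈ cut with suc i ≤? toℕ (hd G b) | a∈
  ... | yes _    | here refl    = refl
  ... | yes i<hd | there a∈rest =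
    ⊥-elim (ℕ.<⇒≱ (proj₁ cut) (ℕ.≤-trans i<hd (start≤tail rest a∈rest)))
  ... | no  i≮hd | here refl    = ⊥-elim (i≮hd (proj₂ cut))
  ... | no  i≮hd | there a∈rest = crossing-≡arc i rest (ℕ.≤-pred (ℕ.≰⇒> i≮hd)) a∈rest cut

  crossing-∈ : ∀ i p {a} → crossing (suc i) p ≡ arc a → a ∈ p
  crossing-∈ i []      ()
  crossing-∈ i (b ∷ p) eq with suc i ≤? toℕ (hd G b)
  crossing-∈ i (b ∷ p) refl | yes _ = here refl
  ... | no _ = there (crossing-∈ i p eq)

  crossing-tail : ∀ {x p} → PathFrom G x p → TailIs G (crossing (suc x) p) x
  crossing-tail         (done 1+x≡n) = 1+x≡n
  crossing-tail {x} (cons {a = a} t _) with suc x ≤? toℕ (hd G a)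
  ... | yes _    = t
  ... | no  x≮hd = ⊥-elim (x≮hd (subst (_< toℕ (hd G a)) t (topOrder a)))

  crossing-extends-after : ∀ x {y p} → PathFrom G y p → y ≤ x → suc (suc x) ≤ nV G →
                           ExtendsAt (suc x) (crossing (suc x) p) (crossing (suc (suc x)) p)
  crossing-extends-after x (done 1+y≡n) y≤x x<n =
    ⊥-elim (ℕ.<⇒≱ x<n (subst (_≤ suc x) 1+y≡n (s≤s y≤x)))
  crossing-extends-after x (cons {a = a} t rest) y≤x x<n
    with suc x ≤? toℕ (hd G a) | suc (suc x) ≤? toℕ (hd G a)
  ... | yes _    | yes _ =
    (λ _ → refl) , λ tl≡1+x → ⊥-elim (ℕ.1+n≰n (subst (_≤ x) (trans (sym t) tl≡1+x) y≤x))
  ... | yes x<hd | no hd≤1+x =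
    (λ ¬t → ⊥-elim (¬t (crossing-tail (subst (λ z → PathFrom G z _) hd≡1+x rest)))) , λ _ → hd≡1+x
    where
    hd≡1+x : toℕ (hd G a) ≡ suc x
    hd≡1+x = ℕ.≤-antisym (ℕ.≤-pred (ℕ.≰⇒> hd≤1+x)) x<hd
  ... | no x≮hd | yes 1+x<hd = ⊥-elim (x≮hd (ℕ.<⇒≤ 1+x<hd))
  ... | no x≮hd | no _       = crossing-extends-after x rest (ℕ.≤-pred (ℕ.≰⇒> x≮hd)) x<n

  crossing-extends : ∀ x {p} → IsSTPath G p → suc x ≤ nV G →
                     ExtendsAt x (crossing x p) (crossing (suc x) p)
  crossing-extends zero    (done 1≡n) _ = (λ ¬t → ⊥-elim (¬t 1≡n)) , λ _ → refl
  crossing-extends zero    (cons {a = a} t _) _ with 1 ≤? toℕ (hd G a)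
  ... | yes _    = (λ ¬t → ⊥-elim (¬t t)) , λ _ → refl
  ... | no  0≮hd = ⊥-elim (0≮hd (ℕ.≤-trans (s≤s z≤n) (topOrder a)))
  crossing-extends (suc x) π x<n = crossing-extends-after x π z≤n x<n

module TableToDecomposition (G : MultiDigraph) (dag : IsSTDAG G)
                            (f : Fin (nA G) → ℕ) (k : ℕ) (w : Fin k → ℤ) where
  open Digraph G
  open STDAG G dag

  extend : List Arc → EArc G → ℕ → List Arc
  extend p (arc a) x = if ⌊ toℕ (tl G a) ≟ℕ x ⌋ then p ++ a ∷ [] else p
  extend p aS      x = p
  extend p aT      x = p

  ∈-extend⁻ : ∀ {a p} e x → a ∈ extend p e x → a ∈ p ⊎ (toℕ (tl G a) ≡ x × e ≡ arc a)
  ∈-extend⁻ {p = p} (arc b) x a∈ with toℕ (tl G b) ≟ℕ x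
  ... | no  _ = inj₁ a∈
  ... | yes t with ∈-++⁻ p a∈
  ...   | inj₁ a∈p       = inj₁ a∈p
  ...   | inj₂ (here refl) = inj₂ (t , refl)
  ∈-extend⁻ aS x a∈ = inj₁ a∈
  ∈-extend⁻ aT x a∈ = inj₁ a∈

  ∈-extend⁺ˡ : ∀ {a p} e x → a ∈ p → a ∈ extend p e x
  ∈-extend⁺ˡ (arc b) x a∈p with toℕ (tl G b) ≟ℕ x
  ... | yes _ = ∈-++⁺ˡ a∈p
  ... | no  _ = a∈p
  ∈-extend⁺ˡ aS x a∈p = a∈p
  ∈-extend⁺ˡ aT x a∈p = a∈p

  ∈-extend⁺ʳ : ∀ {a} p x → toℕ (tl G a) ≡ x → a ∈ extend p (arc a) x
  ∈-extend⁺ʳ {a} p x tl≡x with toℕ (tl G a) ≟ℕ x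
  ... | yes _    = ∈-++⁺ʳ p (here refl)
  ... | no  tl≢x = ⊥-elim (tl≢x tl≡x)

  ∈-extend-new : ∀ {a p} e x → ¬ a ∈ p → toℕ (tl G a) ≡ x → e ≡ arc a ⇔ a ∈ extend p e x
  ∈-extend-new {p = p} e x a∉p tl≡x =
    mk⇔ (λ { refl → ∈-extend⁺ʳ p x tl≡x }) (λ a∈ → [ ⊥-elim ∘ a∉p , proj₂ ] (∈-extend⁻ e x a∈))

  ∈-extend-old : ∀ {a p} e x → toℕ (tl G a) ≢ x → a ∈ p ⇔ a ∈ extend p e x
  ∈-extend-old e x tl≢x =
    mk⇔ (∈-extend⁺ˡ e x) (λ a∈ → [ id , ⊥-elim ∘ tl≢x ∘ proj₁ ] (∈-extend⁻ e x a∈))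

  pathOf : ∀ {x g L} → InTable G k f x g L → Fin k → List Arc
  pathOf base j = []
  pathOf (step {x = x} {g' = g'} _ d _ _) j = extend (pathOf d j) (g' j) x

  Reaches : List Arc → EArc G → Set
  Reaches p (arc a) = Walk 0 p (toℕ (hd G a))
  Reaches p aS      = Walk 0 p 0
  Reaches p aT      = IsSTPath G p

  reaches-head : ∀ {p e x} → Reaches p e → HeadIs G e x → Walk 0 p x
  reaches-head {e = arc a} r refl = r
  reaches-head {e = aS}    r refl = r
  reaches-head {e = aT}    r ()

  reaches-extend : ∀ x {e₀ e} p → ExtendsAt x e₀ e → Reaches p e₀ → Reaches (extend p e x) e
  reaches-extend x {e = arc a} p (same , moved) r with toℕ (tl G a) ≟ℕ x
  ... | yes t  = walk-snoc (reaches-head r (moved t)) t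
  ... | no  ¬t = subst (Reaches p) (same ¬t) r
  reaches-extend x {e = aS} p (same , _) r = subst (Reaches p) (same λ ()) r
  reaches-extend x {e = aT} p (same , moved) r with suc x ≟ℕ nV G
  ... | yes t  = walk⇒path (reaches-head r (moved t)) t
  ... | no  ¬t = subst (Reaches p) (same ¬t) r

  pathOf-reaches : ∀ {x g L} (d : InTable G k f x g L) j → Reaches (pathOf d j) (g j)
  pathOf-reaches base j = nil
  pathOf-reaches (step {x = x} _ d _ ext) j =
    reaches-extend x (pathOf d j) (ext j) (pathOf-reaches d j)

  final-routing-aT : ∀ {x g L} → InTable G k f x g L → x ≡ nV G → ∀ j → g j ≡ aT
  final-routing-aT base 0≡n _ = ⊥-elim (0≢n 0≡n)
  final-routing-aT (step {g' = g'} _ _ r _) 1+x≡n j =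
    InCut-n⇒≡aT (g' j) (Routing.into r j) 1+x≡n

  pathOf-tail< : ∀ {x g L} (d : InTable G k f x g L) j {a} → a ∈ pathOf d j → toℕ (tl G a) < x
  pathOf-tail< (step {g' = g'} _ d _ _) j a∈ with ∈-extend⁻ (g' j) _ a∈
  ... | inj₁ a∈old   = ℕ.m<n⇒m<1+n (pathOf-tail< d j a∈old)
  ... | inj₂ (t , _) = ℕ.≤-reflexive (cong suc t)

  pathOf-flow : ∀ {x g L} (d : InTable G k f x g L) → All (Satisfies G k w) L →
                ∀ a → toℕ (tl G a) < x → + f a ≡ sumℤ (λ j → w j *ℤ + ind G (pathOf d j) a)
  pathOf-flow (step {x = x} {L = L} {g' = g'} _ d _ _) sat a tl<1+x with toℕ (tl G a) ≟ℕ x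
  ... | yes tl≡x = trans (sym new-equation) (sum-preimage w g' _ a λ j →
                     ∈-extend-new (g' j) x (λ a∈ → ℕ.<-irrefl tl≡x (pathOf-tail< d j a∈)) tl≡x)
    where
    new-equation : Satisfies G k w (mkEq (preimage G k g' (arc a)) (f a))
    new-equation = All.lookup (All.map⁻ (All.++⁻ʳ L sat)) (∈-outArcs tl≡x)
  ... | no tl≢x = trans (pathOf-flow d (All.++⁻ˡ L sat) a (ℕ.≤∧≢⇒< (ℕ.≤-pred tl<1+x) tl≢x))
                        (sumℤ-cong λ j → cong (λ i → w j *ℤ + i) (ind-cong (∈-extend-old (g' j) x tl≢x)))

  decomposition : ∀ {g L} → InTable G k f (nV G) g L → Solves G k w L →
                  ∃ λ (P : Fin k → List Arc) → IsFlowDecomposition G f k P w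
  decomposition d s = pathOf d , record
    { paths = λ j → subst (Reaches (pathOf d j)) (final-routing-aT d refl j) (pathOf-reaches d j)
    ; sums  = λ a → pathOf-flow d (Solves⇒All s) a (FP.toℕ<n (tl G a))
    }

module DecompositionToTable (G : MultiDigraph) (dag : IsSTDAG G)
                            (f : Fin (nA G) → ℕ) (flow : IsFlow G f)
                            (k : ℕ) (k≥1 : 1 ≤ k) (w : Fin k → ℤ)
                            (P : Fin k → List (Fin (nA G))) (dec : IsFlowDecomposition G f k P w) where
  open Digraph G
  open STDAG G dag
  open IsSTDAG dag
  open IsFlowDecomposition dec
  open DecMembership (F._≟_ {nA G}) using (_∈?_)

  routingAt : ℕ → Fin k → EArc G
  routingAt i j = crossing i (P j)

  arc-on-some-path : ∀ a → ∃ λ j → a ∈ P j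
  arc-on-some-path a with FP.any? (λ j → a ∈? P j)
  ... | yes found = found
  ... | no  none  = ⊥-elim (ℕ.<⇒≢ (IsFlow.positive flow a) (sym (ℤ.+-injective f≡0)))
    where
    f≡0 : + f a ≡ + 0
    f≡0 = trans (sums a) (trans (sumℤ-cong off-path) (sumℤ-zero k))
      where
      off-path : ∀ j → w j *ℤ + ind G (P j) a ≡ 0ℤ
      off-path j = trans (cong (λ i → w j *ℤ + i) (ind-∉ λ a∈ → none (j , a∈))) (ℤ.*-zeroʳ (w j))

  Σw≡F : sumℤ w ≡ + totalFlow G f
  Σw≡F = sym (begin
    + totalFlow G f
      ≡⟨ +-sumℕ (λ a → if leaves-s a then f a else 0) ⟩
    sumℤ (λ a → + (if leaves-s a then f a else 0))
      ≡⟨ sumℤ-cong flow-out-of-s ⟩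
    sumℤ (λ a → sumℤ (λ j → w j *ℤ first a j))
      ≡⟨ sumℤ-comm (λ a j → w j *ℤ first a j) ⟩
    sumℤ (λ j → sumℤ (λ a → w j *ℤ first a j))
      ≡⟨ sumℤ-cong (λ j → sumℤ-*ˡ (w j) (λ a → first a j)) ⟩
    sumℤ (λ j → w j *ℤ sumℤ (λ a → first a j))
      ≡⟨ sumℤ-cong (λ j → cong (w j *ℤ_) (leaves-s-once (paths j))) ⟩
    sumℤ (λ j → w j *ℤ 1ℤ)
      ≡⟨ sumℤ-cong (λ j → ℤ.*-identityʳ (w j)) ⟩
    sumℤ w ∎)
    where
    open ≡-Reasoning
    leaves-s : Arc → Bool
    leaves-s a = ⌊ toℕ (tl G a) ≟ℕ 0 ⌋
    first : Arc → Fin k → ℤ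
    first a j = if leaves-s a then + ind G (P j) a else 0ℤ
    flow-out-of-s : ∀ a → + (if leaves-s a then f a else 0) ≡ sumℤ (λ j → w j *ℤ first a j)
    flow-out-of-s a with toℕ (tl G a) ≟ℕ 0
    ... | yes _ = sums a
    ... | no  _ = sym (trans (sumℤ-cong λ j → ℤ.*-zeroʳ (w j)) (sumℤ-zero k))

  routing : ∀ x → suc x ≤ nV G → Routing G k (suc x) (routingAt (suc x))
  routing x x<n = record { into = into ; onto = onto }
    where
    into : ∀ j → InCut G (suc x) (routingAt (suc x) j)
    into j = crossing-inCut x (paths j) z≤n x<n
    onto : ∀ e → InCut G (suc x) e → ∃ λ j → routingAt (suc x) j ≡ e
    onto (arc a) cut = let (j , a∈) = arc-on-some-path a in j , crossing-≡arc x (paths j) z≤n a∈ cut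
    onto aS ()
    onto aT 1+x≡n = let j = F.fromℕ< k≥1 in j , InCut-n⇒≡aT _ (into j) 1+x≡n

  new-equation : ∀ x → suc x ≤ nV G → ∀ e → TailIs G e x →
                 Satisfies G k w (mkEq (preimage G k (routingAt (suc x)) e) (fE G f e))
  new-equation x _ (arc a) tl≡x =
    trans (sum-preimage w (routingAt (suc x)) P a routed⇔∈) (sym (sums a))
    where
    cut : InCut G (suc x) (arc a)
    cut = ℕ.≤-reflexive (cong suc tl≡x) , subst (_< toℕ (hd G a)) tl≡x (topOrder a)
    routed⇔∈ : ∀ j → routingAt (suc x) j ≡ arc a ⇔ a ∈ P j
    routed⇔∈ j = mk⇔ (crossing-∈ x (P j)) λ a∈ → crossing-≡arc x (paths j) z≤n a∈ cut
  new-equation x x<n aT 1+x≡n = trans (sumℤ-cong routed-to-aT) Σw≡F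
    where
    routed-to-aT : ∀ j → (if preimage G k (routingAt (suc x)) aT j then w j else 0ℤ) ≡ w j
    routed-to-aT j with _≟E_ G (routingAt (suc x) j) aT
    ... | yes _ = refl
    ... | no ≢aT = ⊥-elim (≢aT (InCut-n⇒≡aT _ (Routing.into (routing x x<n) j) 1+x≡n))

  equations : ℕ → List (Equation G k)
  equations zero    = mkEq (λ _ → true) (totalFlow G f) ∷ []
  equations (suc x) = equations x ++ newEqs G k f x (routingAt (suc x))

  table : ∀ i → i ≤ nV G →
          InTable G k f i (routingAt i) (equations i) × All (Satisfies G k w) (equations i)
  table zero    _   = base , Σw≡F ∷ []
  table (suc x) x<n =
    step x<n (proj₁ previous) (routing x x<n) (λ j → crossing-extends x (paths j) x<n) ,
    All.++⁺ (proj₂ previous) (All.map⁺ (All.map (λ {e} → new-equation x x<n e) (outArcs-tails x)))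
    where
    previous : InTable G k f x (routingAt x) (equations x) × All (Satisfies G k w) (equations x)
    previous = table x (ℕ.≤-trans (ℕ.n≤1+n x) x<n)

  solution : ∃ λ g → ∃ λ L → InTable G k f (nV G) g L × Solves G k w L
  solution = let (t , sat) = table (nV G) ℕ.≤-refl in
             routingAt (nV G) , equations (nV G) , t , All⇒Solves sat

lemma1 : (G : MultiDigraph) → IsSTDAG G →
         (f : Fin (nA G) → ℕ) → IsFlow G f →
         (k : ℕ) → 1 ≤ k → (w : Fin k → ℤ) →
         (∃ λ g → ∃ λ L → InTable G k f (nV G) g L × Solves G k w L)
         ⇔ (∃ λ (P : Fin k → List (Fin (nA G))) → IsFlowDecomposition G f k P w)
lemma1 G dag f flow k k≥1 w = mk⇔
  (λ (_ , _ , d , s) → TableToDecomposition.decomposition G dag f k w d s)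
  (λ (P , dec) → DecompositionToTable.solution G dag f flow k k≥1 w P dec)
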